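{- Consider the following construction. Fix a finite alphabet $\mathcal{A}_0$ and sequences of positive integers $(k_n)_{n\ge0}$, $(r_n)_{n\ge0}$ with $r_n\le2k_n$. Let $\mathcal{A}_1=\mathcal{A}_0$ and $\tau_0\colon\mathcal{A}_1^*\to\mathcal{A}_0^*$ the identity. For $n\ge1$, once $\mathcal{A}_n$ is defined, fix a primitive word $v_nu_n\in\mathcal{A}_n^*$ with $|u_n|=|v_n|=r_n$, let $W_n$ be the set of words $w\in\mathcal{A}_n^*$ that begin with $u_n$, end with $v_n$, and satisfy $|w|_a=k_n$ for all $a\in\mathcal{A}_n$, and let $\tau_n\colon\mathcal{A}_{n+1}\to W_n$ be a bijection from an alphabet $\mathcal{A}_{n+1}$ onto $W_n$, extended to a substitution $\mathcal{A}_{n+1}^*\to\mathcal{A}_n^*$. For $m>n\ge0$ let $\tau_{n,m}=\tau_n\circ\tau_{n+1}\circ\cdots\circ\tau_{m-1}$. Then for every $m>n\ge0$, the map $\mathcal{A}_m\to\mathcal{A}_n^*$, $a\mapsto\tau_{n,m}(a)$, is injective.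
   Context: A word is primitive if it is not of the form $z^j$ with $j\ge2$; $|w|_a$ is the number of occurrences of the letter $a$ in $w$. A substitution is a monoid morphism between free monoids. -}

module Defs where

open import Data.Nat using (ℕ; zero; suc; _+_; _*_; _≤_)
open import Data.Fin using (Fin; cast)
open import Data.Fin.Properties using (_≟_)
open import Data.List using (List; []; _∷_; [_]; _++_; length; concat; replicate; concatMap; filter)
open import Data.Product using (Σ; ∃; _×_; _,_)
open import Relation.Binary.PropositionalEquality using (_≡_)
open import Relation.Nullary using (¬_)
open import Function.Definitions using (Injective)

occ : {n : ℕ} → Fin n → List (Fin n) → ℕ
occ a w = length (filter (_≟ a) w)

Primitive : {A : Set} → List A → Set
Primitive {A} w = (z : List A) (j : ℕ) → 2 ≤ j → ¬ (w ≡ concat (replicate j z))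

StartsWith : {A : Set} → List A → List A → Set
StartsWith u w = ∃ λ t → w ≡ u ++ t

EndsWith : {A : Set} → List A → List A → Set
EndsWith v w = ∃ λ t → w ≡ t ++ v

-- The construction. Alphabet 𝒜ₙ is Fin (s n).
-- u n, v n stand for u_{n+1}, v_{n+1} (words over 𝒜_{n+1}), n ≥ 0.
-- τ n : 𝒜_{n+1} → 𝒜ₙ*.
record Construction : Set where
  field
    k r s : ℕ → ℕ
    k-pos : ∀ n → 1 ≤ k n
    r-pos : ∀ n → 1 ≤ r n
    r≤2k  : ∀ n → r n ≤ 2 * k n
    s₁≡s₀ : s 1 ≡ s 0
    u v   : (n : ℕ) → List (Fin (s (suc n)))
    |u|   : ∀ n → length (u n) ≡ r (suc n)
    |v|   : ∀ n → length (v n) ≡ r (suc n)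
    vu-prim : ∀ n → Primitive (v n ++ u n)
    τ     : (n : ℕ) → Fin (s (suc n)) → List (Fin (s n))
    τ₀-id : ∀ a → τ 0 a ≡ [ cast s₁≡s₀ a ]
    τ-inj  : ∀ n → Injective _≡_ _≡_ (τ (suc n))
    τ-into : ∀ n a → StartsWith (u n) (τ (suc n) a)
                   × EndsWith (v n) (τ (suc n) a)
                   × (∀ b → occ b (τ (suc n) a) ≡ k (suc n))
    τ-onto : ∀ n (w : List (Fin (s (suc n))))
             → StartsWith (u n) w → EndsWith (v n) w
             → (∀ b → occ b w ≡ k (suc n))
             → ∃ λ a → τ (suc n) a ≡ w

  τ* : (n : ℕ) → List (Fin (s (suc n))) → List (Fin (s n))
  τ* n = concatMap (τ n)

  -- τ-comp n d = τ_{n,m} on words, with m = suc d + n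
  τ-comp : (n d : ℕ) → List (Fin (s (suc (d + n)))) → List (Fin (s n))
  τ-comp n zero w = τ* n w
  τ-comp n (suc d) w = τ-comp n d (τ* (suc (d + n)) w)

{-# OPTIONS --safe #-}
-- For n ≥ 1 the words τₙ(a), a ∈ 𝒜ₙ₊₁, are pairwise distinct, nonempty (they begin with uₙ
-- and rₙ ≥ 1) and of one common length, since |w| = Σ_b |w|_b = kₙ · #𝒜ₙ; τ₀ renames letters.
-- A code of distinct nonempty words of equal length is uniquely decodable (cut a word into
-- blocks of that length), so every substitution τₙ is injective on words, hence so is the
-- composite τₙ,ₘ, in particular on letters.
module Submission where

open import Defs
open import Data.Nat.Properties using (suc-injective; +-0-commutativeMonoid)
open import Algebra.Properties.CommutativeMonoid.Sum +-0-commutativeMonoid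
  using (sum; sum-syntax; sum-cong-≗; sum-remove; sum-replicate-zero; ∑-distrib-+)
open import Data.Nat using (ℕ; zero; suc; _+_; _≤_)
open import Data.Fin using (Fin; cast; punchIn)
open import Data.Fin.Properties using (_≟_; cast-involutive; punchInᵢ≢i)
open import Data.List using (List; []; _∷_; [_]; _++_; length; concatMap)
open import Data.List.Properties using (∷-injective; ∷-injectiveˡ; ++-conicalˡ)
open import Data.Product using (_×_; _,_; proj₁; proj₂)
open import Function.Base using (_∘_)
open import Function.Definitions using (Injective)
open import Relation.Binary.PropositionalEquality
  using (_≡_; _≢_; refl; sym; trans; cong; cong₂; module ≡-Reasoning)
open import Relation.Nullary using (yes; no; contradiction)
open Construction

δ : {m : ℕ} → Fin m → Fin m → ℕ
δ c b with c ≟ b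
... | yes _ = 1
... | no  _ = 0

δ-diag : {m : ℕ} (c : Fin m) → δ c c ≡ 1
δ-diag c with c ≟ c
... | yes _   = refl
... | no  c≢c = contradiction refl c≢c

∑-δ : {m : ℕ} (c : Fin m) → ∑[ b < m ] δ c b ≡ 1
∑-δ {suc m} c = begin
  sum (δ c)                        ≡⟨ sum-remove {i = c} (δ c) ⟩
  δ c c + sum (δ c ∘ punchIn c)    ≡⟨ cong₂ _+_ (δ-diag c) (sum-cong-≗ off-diagonal) ⟩
  1 + ∑[ _ < m ] 0                 ≡⟨ cong suc (sum-replicate-zero m) ⟩
  1                                ∎
  where
  open ≡-Reasoning
  off-diagonal : (j : Fin m) → δ c (punchIn c j) ≡ 0
  off-diagonal j with c ≟ punchIn c j
  ... | yes c≡ = contradiction (sym c≡) (punchInᵢ≢i c j)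
  ... | no  _  = refl

occ-∷ : {m : ℕ} (c b : Fin m) (w : List (Fin m)) → occ b (c ∷ w) ≡ δ c b + occ b w
occ-∷ c b w with c ≟ b
... | yes _ = refl
... | no  _ = refl

length≡∑occ : {m : ℕ} (w : List (Fin m)) → length w ≡ ∑[ b < m ] occ b w
length≡∑occ {m} [] = sym (sum-replicate-zero m)
length≡∑occ {m} (c ∷ w) = begin
  suc (length w)                   ≡⟨ cong₂ _+_ (sym (∑-δ c)) (length≡∑occ w) ⟩
  sum (δ c) + ∑[ b < m ] occ b w   ≡⟨ sym (∑-distrib-+ (δ c) (λ b → occ b w)) ⟩
  ∑[ b < m ] (δ c b + occ b w)     ≡⟨ sum-cong-≗ (λ b → sym (occ-∷ c b w)) ⟩
  ∑[ b < m ] occ b (c ∷ w)         ∎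
  where open ≡-Reasoning

occ-equal⇒length-equal : {m : ℕ} (x y : List (Fin m)) → (∀ b → occ b x ≡ occ b y) → length x ≡ length y
occ-equal⇒length-equal x y occ≡ = begin
  length x             ≡⟨ length≡∑occ x ⟩
  sum (λ b → occ b x)  ≡⟨ sum-cong-≗ occ≡ ⟩
  sum (λ b → occ b y)  ≡⟨ sym (length≡∑occ y) ⟩
  length y             ∎
  where open ≡-Reasoning

positive-length⇒nonempty : {A : Set} {u : List A} {r : ℕ} → 1 ≤ r → length u ≡ r → u ≢ []
positive-length⇒nonempty () refl refl

startsWith-nonempty : {A : Set} {u w : List A} → StartsWith u w → u ≢ [] → w ≢ []
startsWith-nonempty (t , refl) u≢[] = u≢[] ∘ ++-conicalˡ _ t

++-cancel-equal-length : {A : Set} (xs ys : List A) {zs ws : List A}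
  → length xs ≡ length ys → xs ++ zs ≡ ys ++ ws → xs ≡ ys × zs ≡ ws
++-cancel-equal-length []       []       _   eq = refl , eq
++-cancel-equal-length (x ∷ xs) (y ∷ ys) len eq with ∷-injective eq
... | refl , eq′ with ++-cancel-equal-length xs ys (suc-injective len) eq′
...   | refl , zs≡ws = refl , zs≡ws

cast-injective : {m n : ℕ} .(eq : m ≡ n) → Injective _≡_ _≡_ (cast eq)
cast-injective eq {a} {b} e = begin
  a                         ≡⟨ sym (cast-involutive (sym eq) eq a) ⟩
  cast (sym eq) (cast eq a) ≡⟨ cong (cast (sym eq)) e ⟩
  cast (sym eq) (cast eq b) ≡⟨ cast-involutive (sym eq) eq b ⟩
  b                         ∎
  where open ≡-Reasoning

record UniformCode {A B : Set} (f : A → List B) : Set where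
  field
    equal-lengths : ∀ a b → length (f a) ≡ length (f b)
    nonempty      : ∀ a → f a ≢ []
    injective     : Injective _≡_ _≡_ f

concatMap-injective : {A B : Set} {f : A → List B} → UniformCode f → Injective _≡_ _≡_ (concatMap f)
concatMap-injective         code {[]}    {[]}    _  = refl
concatMap-injective {f = f} code {[]}    {b ∷ y} eq =
  contradiction (++-conicalˡ (f b) _ (sym eq)) (UniformCode.nonempty code b)
concatMap-injective {f = f} code {a ∷ x} {[]}    eq =
  contradiction (++-conicalˡ (f a) _ eq) (UniformCode.nonempty code a)
concatMap-injective {f = f} code {a ∷ x} {b ∷ y} eq
  with ++-cancel-equal-length (f a) (f b) (UniformCode.equal-lengths code a b) eq
... | fa≡fb , rest = cong₂ _∷_ (UniformCode.injective code fa≡fb) (concatMap-injective code rest)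

τ-uniformCode : (C : Construction) (n : ℕ) → UniformCode (τ C n)
τ-uniformCode C zero = record
  { equal-lengths = λ a b → trans (cong length (τ₀-id C a)) (sym (cong length (τ₀-id C b)))
  ; nonempty      = λ a eq → contradiction (trans (sym (τ₀-id C a)) eq) λ ()
  ; injective     = λ {a} {b} eq →
      cast-injective (s₁≡s₀ C) (∷-injectiveˡ (trans (sym (τ₀-id C a)) (trans eq (τ₀-id C b))))
  }
τ-uniformCode C (suc n) = record
  { equal-lengths = λ a b → occ-equal⇒length-equal (τ C (suc n) a) (τ C (suc n) b)
                              λ c → trans (occ≡k a c) (sym (occ≡k b c))
  ; nonempty      = λ a → startsWith-nonempty (proj₁ (τ-into C n a))
                            (positive-length⇒nonempty (r-pos C (suc n)) (|u| C n))
  ; injective     = τ-inj C n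
  }
  where
  occ≡k : ∀ a c → occ c (τ C (suc n) a) ≡ k C (suc n)
  occ≡k a = proj₂ (proj₂ (τ-into C n a))

τ-comp-injective : (C : Construction) (n d : ℕ) → Injective _≡_ _≡_ (τ-comp C n d)
τ-comp-injective C n zero    = concatMap-injective (τ-uniformCode C n)
τ-comp-injective C n (suc d) = concatMap-injective (τ-uniformCode C (suc (d + n))) ∘ τ-comp-injective C n d

lemma7p10 : (C : Construction) (n d : ℕ)
    → Injective _≡_ _≡_ (λ (a : Fin (s C (suc (d + n)))) → τ-comp C n d [ a ])
lemma7p10 C n d = ∷-injectiveˡ ∘ τ-comp-injective C n d
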